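{- For objects $A,B$ of the presheaf topos $[\mathcal W^{op},\mathbf{Set}]$ let $\sigma(A,B)=\prod_{p\in\mathbb A}\big([A\to\llbracket p\rrbracket]\to([B\to\llbracket p\rrbracket]\to\llbracket p\rrbracket)\big)$. Then for every formula $\phi$, $\sigma$ supports disjunction elimination for $\llbracket\phi\rrbracket$, i.e. there is a morphism $\sigma(A,B)\times[A\to\llbracket\phi\rrbracket]\times[B\to\llbracket\phi\rrbracket]\to\llbracket\phi\rrbracket$.
   Context: Fix a countable set $\mathbb A$ of atoms; formulae are built from atoms and $\bot$ with $\wedge,\vee,\supset$. An atomic rule is $\mathcal R=((P_1\Rightarrow q_1),\dots,(P_n\Rightarrow q_n))\Rightarrow r$ with $n\ge0$, $P_i$ finite sets of atoms, $q_i,r$ atoms. A base is a countable set of atomic rules. A context $(X:P)$ is a finite list $x_1:p_1,\dots,x_m:p_m$. Derivation terms $\Phi::=x\mid\Phi_{\mathcal R}(\Phi_1,\dots,\Phi_n)$; derivations in base $\mathcal B$ generated by $(X:P),x:p\vdash_{\mathcal B}x:p$ and, for $\mathcal R\in\mathcal B$, from $(X:P),(X_i:P_i)\vdash_{\mathcal B}\Phi_i:q_i$ infer $(X:P)\vdash_{\mathcal B}\Phi_{\mathcal R}(\Phi_1,\dots,\Phi_n):r$. The category $\mathcal W$ has objects $(\mathcal B,(X:P))$; a morphism $(\mathcal B,(X:P))\to(\mathcal C,(Y:Q))$, $Y:Q=y_1:q_1,\dots,y_m:q_m$, exists only when $\mathcal C\subseteq\mathcal B$ and is a tuple of derivations $(X:P)\vdash_{\mathcal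 B}\Phi_i:q_i$; identities are variable tuples, composition is simultaneous substitution. $[F\to G]$ (also written $F\supset G$) is the exponential: $[F\to G](w)$ = natural transformations $\mathcal W(-,w)\times F\to G$. Interpretation: $\llbracket p\rrbracket(\mathcal B,(X:P))$ = set of derivations $(X:P)\vdash_{\mathcal B}\Phi:p$, action by substitution; $\llbracket\phi\wedge\psi\rrbracket=\llbracket\phi\rrbracket\times\llbracket\psi\rrbracket$; $\llbracket\phi\supset\psi\rrbracket=[\llbracket\phi\rrbracket\to\llbracket\psi\rrbracket]$; $\llbracket\phi\vee\psi\rrbracket=\prod_{p\in\mathbb A}\big([\llbracket\phi\rrbracket\to\llbracket p\rrbracket]\to([\llbracket\psi\rrbracket\to\llbracket p\rrbracket]\to\llbracket p\rrbracket)\big)$; $\llbracket\bot\rrbracket=\prod_{p\in\mathbb A}\llbracket p\rrbracket$. $\sigma$ supports disjunction elimination for $C$ if there is a morphism $\sigma(A,B)\times[A\to C]\times[B\to C]\to C$. -}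

module Defs where

open import Level using (Level; 0ℓ) renaming (suc to lsuc)
open import Data.Nat using (ℕ)
open import Data.List using (List; []; _∷_; _++_)
open import Data.List.Membership.Propositional using (_∈_)
open import Data.List.Relation.Unary.All as All using (All)
open import Data.List.Relation.Unary.All.Properties as AllP using ()
open import Data.List.Relation.Unary.Any using (here; there)
open import Data.List.Relation.Unary.Any.Properties using (++⁺ˡ; ++⁺ʳ; ++⁻)
open import Data.Product using (_×_; _,_; proj₁; proj₂)
open import Data.Sum using (_⊎_; inj₁; inj₂)
open import Function using (_∘_)
open import Relation.Binary.Structures using (IsEquivalence)
open import Relation.Binary.PropositionalEquality
  using (_≡_; refl; sym; trans; cong; cong₂; isEquivalence; module ≡-Reasoning)

Atom : Set
Atom = ℕ

infixr 6 _∧_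
infixr 5 _∨_
infixr 4 _⊃_

data Formula : Set where
  atom : Atom → Formula
  ⊥f   : Formula
  _∧_  : Formula → Formula → Formula
  _∨_  : Formula → Formula → Formula
  _⊃_  : Formula → Formula → Formula

-- a context (X : P) is a finite list of typed variables; variables are
-- de Bruijn positions, so a context is represented by its list of atoms
Ctx : Set
Ctx = List Atom

-- ((P₁ ⇒ q₁), … , (Pₙ ⇒ qₙ)) ⇒ r ; the finite sets Pᵢ are given as lists
record Rule : Set where
  constructor _⇒_
  field
    prems : List (List Atom × Atom)
    concl : Atom
open Rule public

Base : Set₁
Base = Rule → Set

_⊆B_ : Base → Base → Set
C ⊆B B = ∀ R → C R → B R

-- Derivations  (X:P) ⊢_B Φ : p
-- (the proof that the rule lies in the base is irrelevant: a derivation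
-- is just its term Φ)

mutual
  data Der (B : Base) (Γ : Ctx) : Atom → Set where
    var  : ∀ {p} → p ∈ Γ → Der B Γ p
    rule : (R : Rule) → .(B R) → Ders B Γ (prems R) → Der B Γ (concl R)

  data Ders (B : Base) (Γ : Ctx) : List (List Atom × Atom) → Set where
    []  : Ders B Γ []
    _∷_ : ∀ {P q ps} → Der B (Γ ++ P) q → Ders B Γ ps → Ders B Γ ((P , q) ∷ ps)

Ren : Ctx → Ctx → Set
Ren Γ Δ = ∀ {p} → p ∈ Γ → p ∈ Δ

Sub : Base → Ctx → Ctx → Set
Sub B Γ Δ = ∀ {p} → p ∈ Γ → Der B Δ p

extS : ∀ {Γ Δ P p} → Ren Γ Δ → p ∈ Γ ⊎ p ∈ P → p ∈ Δ ++ P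
extS ρ (inj₁ y) = ++⁺ˡ (ρ y)
extS {Δ = Δ} ρ (inj₂ y) = ++⁺ʳ Δ y

ext : ∀ {Γ Δ P} → Ren Γ Δ → Ren (Γ ++ P) (Δ ++ P)
ext {Γ} ρ x = extS ρ (++⁻ Γ x)

mutual
  rename : ∀ {B Γ Δ p} → Ren Γ Δ → Der B Γ p → Der B Δ p
  rename ρ (var x) = var (ρ x)
  rename ρ (rule R m ds) = rule R m (renames ρ ds)

  renames : ∀ {B Γ Δ ps} → Ren Γ Δ → Ders B Γ ps → Ders B Δ ps
  renames ρ [] = []
  renames ρ (d ∷ ds) = rename (ext ρ) d ∷ renames ρ ds

extsS : ∀ {B Γ Δ P p} → Sub B Γ Δ → p ∈ Γ ⊎ p ∈ P → Der B (Δ ++ P) p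
extsS σ (inj₁ y) = rename ++⁺ˡ (σ y)
extsS {Δ = Δ} σ (inj₂ y) = var (++⁺ʳ Δ y)

exts : ∀ {B Γ Δ P} → Sub B Γ Δ → Sub B (Γ ++ P) (Δ ++ P)
exts {Γ = Γ} σ x = extsS σ (++⁻ Γ x)

mutual
  subst : ∀ {C B Γ Δ p} → .(C ⊆B B) → Sub B Γ Δ → Der C Γ p → Der B Δ p
  subst i σ (var x) = σ x
  subst i σ (rule R m ds) = rule R (i R m) (substs i σ ds)

  substs : ∀ {C B Γ Δ ps} → .(C ⊆B B) → Sub B Γ Δ → Ders C Γ ps → Ders B Δ ps
  substs i σ [] = []
  substs i σ (d ∷ ds) = subst i (exts σ) d ∷ substs i σ ds

-- Metatheory of substitution (needed to make W a category and to
-- define the action of exponentials)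

private
  split-l : ∀ (Γ : Ctx) {P : Ctx} {p : Atom} (x : p ∈ Γ) → ++⁻ Γ {P} (++⁺ˡ x) ≡ inj₁ x
  split-l (a ∷ Γ) (here e) = refl
  split-l (a ∷ Γ) {P} (there x) rewrite split-l Γ {P} x = refl

  split-r : ∀ (Γ : Ctx) {P : Ctx} {p : Atom} (x : p ∈ P) → ++⁻ Γ (++⁺ʳ Γ x) ≡ inj₂ x
  split-r [] x = refl
  split-r (a ∷ Γ) x rewrite split-r Γ x = refl

  extS-cong : ∀ {Γ Δ P p} {ρ ρ' : Ren Γ Δ} → (∀ {q} (x : q ∈ Γ) → ρ x ≡ ρ' x)
            → (s : p ∈ Γ ⊎ p ∈ P) → extS ρ s ≡ extS ρ' s
  extS-cong h (inj₁ y) = cong ++⁺ˡ (h y)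
  extS-cong h (inj₂ y) = refl

  mutual
    rename-cong : ∀ {B Γ Δ p} {ρ ρ' : Ren Γ Δ} → (∀ {q} (x : q ∈ Γ) → ρ x ≡ ρ' x)
                → (d : Der B Γ p) → rename ρ d ≡ rename ρ' d
    rename-cong h (var x) = cong var (h x)
    rename-cong h (rule R m ds) = cong (rule R m) (renames-cong h ds)

    renames-cong : ∀ {B Γ Δ ps} {ρ ρ' : Ren Γ Δ} → (∀ {q} (x : q ∈ Γ) → ρ x ≡ ρ' x)
                 → (ds : Ders B Γ ps) → renames ρ ds ≡ renames ρ' ds
    renames-cong h [] = refl
    renames-cong {Γ = Γ} h (d ∷ ds) =
      cong₂ _∷_ (rename-cong (λ x → extS-cong h (++⁻ Γ x)) d) (renames-cong h ds)

  ext-ext : ∀ {Γ Δ Θ P p} (ρ : Ren Γ Δ) (ρ' : Ren Δ Θ) (x : p ∈ Γ ++ P)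
          → ext ρ' (ext ρ x) ≡ ext (ρ' ∘ ρ) x
  ext-ext {Γ} {Δ} {P = P} ρ ρ' x with ++⁻ Γ x
  ... | inj₁ y rewrite split-l Δ {P} (ρ y) = refl
  ... | inj₂ y rewrite split-r Δ y = refl

  mutual
    rename-rename : ∀ {B Γ Δ Θ p} (ρ : Ren Γ Δ) (ρ' : Ren Δ Θ) (d : Der B Γ p)
                  → rename ρ' (rename ρ d) ≡ rename (ρ' ∘ ρ) d
    rename-rename ρ ρ' (var x) = refl
    rename-rename ρ ρ' (rule R m ds) = cong (rule R m) (renames-renames ρ ρ' ds)

    renames-renames : ∀ {B Γ Δ Θ ps} (ρ : Ren Γ Δ) (ρ' : Ren Δ Θ) (ds : Ders B Γ ps)
                    → renames ρ' (renames ρ ds) ≡ renames (ρ' ∘ ρ) ds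
    renames-renames ρ ρ' [] = refl
    renames-renames ρ ρ' (d ∷ ds) =
      cong₂ _∷_ (trans (rename-rename (ext ρ) (ext ρ') d)
                       (rename-cong (ext-ext ρ ρ') d))
                (renames-renames ρ ρ' ds)

  extsS-cong : ∀ {B Γ Δ P p} {σ σ' : Sub B Γ Δ} → (∀ {q} (x : q ∈ Γ) → σ x ≡ σ' x)
             → (s : p ∈ Γ ⊎ p ∈ P) → extsS σ s ≡ extsS σ' s
  extsS-cong h (inj₁ y) = cong (rename ++⁺ˡ) (h y)
  extsS-cong h (inj₂ y) = refl

  mutual
    subst-cong : ∀ {C B Γ Δ p} .(i : C ⊆B B) {σ σ' : Sub B Γ Δ}
               → (∀ {q} (x : q ∈ Γ) → σ x ≡ σ' x)
               → (d : Der C Γ p) → subst i σ d ≡ subst i σ' d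
    subst-cong i h (var x) = h x
    subst-cong i h (rule R m ds) = cong (rule R (i R m)) (substs-cong i h ds)

    substs-cong : ∀ {C B Γ Δ ps} .(i : C ⊆B B) {σ σ' : Sub B Γ Δ}
                → (∀ {q} (x : q ∈ Γ) → σ x ≡ σ' x)
                → (ds : Ders C Γ ps) → substs i σ ds ≡ substs i σ' ds
    substs-cong i h [] = refl
    substs-cong {Γ = Γ} i h (d ∷ ds) =
      cong₂ _∷_ (subst-cong i (λ x → extsS-cong h (++⁻ Γ x)) d) (substs-cong i h ds)

  exts-ext : ∀ {B Γ Δ Θ P p} (ρ : Ren Γ Δ) (σ : Sub B Δ Θ) (x : p ∈ Γ ++ P)
           → exts σ (ext ρ x) ≡ exts (σ ∘ ρ) x
  exts-ext {Γ = Γ} {Δ} {P = P} ρ σ x with ++⁻ Γ x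
  ... | inj₁ y rewrite split-l Δ {P} (ρ y) = refl
  ... | inj₂ y rewrite split-r Δ y = refl

  mutual
    subst-rename : ∀ {C B Γ Δ Θ p} .(i : C ⊆B B) (ρ : Ren Γ Δ) (σ : Sub B Δ Θ)
                   (d : Der C Γ p) → subst i σ (rename ρ d) ≡ subst i (σ ∘ ρ) d
    subst-rename i ρ σ (var x) = refl
    subst-rename i ρ σ (rule R m ds) = cong (rule R (i R m)) (substs-renames i ρ σ ds)

    substs-renames : ∀ {C B Γ Δ Θ ps} .(i : C ⊆B B) (ρ : Ren Γ Δ) (σ : Sub B Δ Θ)
                     (ds : Ders C Γ ps) → substs i σ (renames ρ ds) ≡ substs i (σ ∘ ρ) ds
    substs-renames i ρ σ [] = refl
    substs-renames i ρ σ (d ∷ ds) =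
      cong₂ _∷_ (trans (subst-rename i (ext ρ) (exts σ) d)
                       (subst-cong i (exts-ext ρ σ) d))
                (substs-renames i ρ σ ds)

  ext-exts : ∀ {B Γ Δ Θ P p} (σ : Sub B Γ Δ) (ρ : Ren Δ Θ) (x : p ∈ Γ ++ P)
           → rename (ext ρ) (exts σ x) ≡ exts (rename ρ ∘ σ) x
  ext-exts {Γ = Γ} {Δ} {P = P} σ ρ x with ++⁻ Γ x
  ... | inj₁ y = trans (rename-rename ++⁺ˡ (ext ρ) (σ y))
                  (trans (rename-cong (λ z → cong (extS ρ) (split-l Δ {P} z)) (σ y))
                         (sym (rename-rename ρ ++⁺ˡ (σ y))))
  ... | inj₂ y rewrite split-r Δ y = refl

  mutual
    rename-subst : ∀ {C B Γ Δ Θ p} .(i : C ⊆B B) (σ : Sub B Γ Δ) (ρ : Ren Δ Θ)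
                   (d : Der C Γ p) → rename ρ (subst i σ d) ≡ subst i (rename ρ ∘ σ) d
    rename-subst i σ ρ (var x) = refl
    rename-subst i σ ρ (rule R m ds) = cong (rule R (i R m)) (renames-substs i σ ρ ds)

    renames-substs : ∀ {C B Γ Δ Θ ps} .(i : C ⊆B B) (σ : Sub B Γ Δ) (ρ : Ren Δ Θ)
                     (ds : Ders C Γ ps) → renames ρ (substs i σ ds) ≡ substs i (rename ρ ∘ σ) ds
    renames-substs i σ ρ [] = refl
    renames-substs i σ ρ (d ∷ ds) =
      cong₂ _∷_ (trans (rename-subst i (exts σ) (ext ρ) d)
                       (subst-cong i (ext-exts σ ρ) d))
                (renames-substs i σ ρ ds)

  exts-exts : ∀ {A B Γ Δ Θ P p} .(j : B ⊆B A) (σ : Sub B Γ Δ) (τ : Sub A Δ Θ)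
              (x : p ∈ Γ ++ P) → subst j (exts τ) (exts σ x) ≡ exts (subst j τ ∘ σ) x
  exts-exts {Γ = Γ} {Δ} {P = P} j σ τ x with ++⁻ Γ x
  ... | inj₁ y = trans (subst-rename j ++⁺ˡ (exts τ) (σ y))
                  (trans (subst-cong j (λ z → cong (extsS τ) (split-l Δ {P} z)) (σ y))
                         (sym (rename-subst j τ ++⁺ˡ (σ y))))
  ... | inj₂ y rewrite split-r Δ y = refl

  mutual
    subst-subst : ∀ {D C B Γ Δ Θ p} .(i : D ⊆B C) .(j : C ⊆B B)
                  (σ : Sub C Γ Δ) (τ : Sub B Δ Θ) (d : Der D Γ p)
                → subst j τ (subst i σ d) ≡ subst (λ R → j R ∘ i R) (subst j τ ∘ σ) d
    subst-subst i j σ τ (var x) = refl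
    subst-subst i j σ τ (rule R m ds) =
      cong (rule R (j R (i R m))) (substs-substs i j σ τ ds)

    substs-substs : ∀ {D C B Γ Δ Θ ps} .(i : D ⊆B C) .(j : C ⊆B B)
                    (σ : Sub C Γ Δ) (τ : Sub B Δ Θ) (ds : Ders D Γ ps)
                  → substs j τ (substs i σ ds) ≡ substs (λ R → j R ∘ i R) (subst j τ ∘ σ) ds
    substs-substs i j σ τ [] = refl
    substs-substs i j σ τ (d ∷ ds) =
      cong₂ _∷_ (trans (subst-subst i j (exts σ) (exts τ) d)
                       (subst-cong _ (exts-exts j σ τ) d))
                (substs-substs i j σ τ ds)

record World : Set₁ where
  constructor ⟨_,_⟩
  field
    base : Base
    ctx  : Ctx
open World public

-- a morphism (B,(X:P)) → (C,(Y:Q)) exists only when C ⊆ B, and is a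
-- tuple of derivations (X:P) ⊢_B Φᵢ : qᵢ
record Hom (v w : World) : Set where
  constructor hom
  field
    .incl : base w ⊆B base v
    terms : All (Der (base v) (ctx v)) (ctx w)
open Hom public

idW : ∀ {w} → Hom w w
idW = hom (λ R m → m) (All.tabulate var)

infixr 9 _∘W_
_∘W_ : ∀ {u v w} → Hom v w → Hom u v → Hom u w
hom i t ∘W hom j s = hom (λ R m → j R (i R m)) (All.map (subst j (All.lookup s)) t)

substH : ∀ {v w p} → Hom v w → Der (base w) (ctx w) p → Der (base v) (ctx v) p
substH (hom i t) = subst i (All.lookup t)

∘W-assoc : ∀ {t u v w} (f : Hom v w) (g : Hom u v) (h : Hom t u)
         → (f ∘W g) ∘W h ≡ f ∘W (g ∘W h)
∘W-assoc (hom i tf) (hom j tg) (hom k th) = cong (hom _) (begin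
    All.map (subst k (All.lookup th)) (All.map (subst j (All.lookup tg)) tf)
  ≡⟨ AllP.map-∘ tf ⟩
    All.map (λ d → subst k (All.lookup th) (subst j (All.lookup tg) d)) tf
  ≡⟨ AllP.map-cong tf (λ d →
       trans (subst-subst j k (All.lookup tg) (All.lookup th) d)
             (subst-cong _ (λ x → sym (AllP.lookup-map tg x)) d)) ⟩
    All.map (subst (λ R m → k R (j R m))
               (All.lookup (All.map (subst k (All.lookup th)) tg))) tf
  ∎)
  where open ≡-Reasoning

-- Objects of [𝒲^op, Set] are represented as setoid-valued presheaves
-- (needed because the elements of exponentials are natural
-- transformations, whose equality is extensional).

record PSh : Set₂ where
  field
    Ob     : World → Set₁
    _≈_    : ∀ {w} → Ob w → Ob w → Set₁
    isEq   : ∀ {w} → IsEquivalence (_≈_ {w})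
    act    : ∀ {v w} → Hom v w → Ob w → Ob v
    act-cong : ∀ {v w} (f : Hom v w) {x y : Ob w} → x ≈ y → act f x ≈ act f y
open PSh public

record Presheaf : Set₂ where
  field
    psh    : PSh
    act-id : ∀ {w} (x : Ob psh w) → _≈_ psh (act psh idW x) x
    act-∘  : ∀ {u v w} (f : Hom v w) (g : Hom u v) (x : Ob psh w)
           → _≈_ psh (act psh (f ∘W g) x) (act psh g (act psh f x))
open Presheaf public

record Mor (F G : PSh) : Set₁ where
  field
    η       : ∀ {w} → Ob F w → Ob G w
    η-cong  : ∀ {w} {x y : Ob F w} → _≈_ F x y → _≈_ G (η x) (η y)
    natural : ∀ {v w} (f : Hom v w) (x : Ob F w)
            → _≈_ G (η (act F f x)) (act G f (η x))
open Mor public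

_×P_ : PSh → PSh → PSh
F ×P G = record
  { Ob = λ w → Ob F w × Ob G w
  ; _≈_ = λ x y → _≈_ F (proj₁ x) (proj₁ y) × _≈_ G (proj₂ x) (proj₂ y)
  ; isEq = record
      { refl = IsEquivalence.refl (isEq F) , IsEquivalence.refl (isEq G)
      ; sym = λ e → IsEquivalence.sym (isEq F) (proj₁ e) , IsEquivalence.sym (isEq G) (proj₂ e)
      ; trans = λ e e' → IsEquivalence.trans (isEq F) (proj₁ e) (proj₁ e')
                        , IsEquivalence.trans (isEq G) (proj₂ e) (proj₂ e') }
  ; act = λ f x → act F f (proj₁ x) , act G f (proj₂ x)
  ; act-cong = λ f e → act-cong F f (proj₁ e) , act-cong G f (proj₂ e)
  }

ΠA : (Atom → PSh) → PSh
ΠA F = record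
  { Ob = λ w → (p : Atom) → Ob (F p) w
  ; _≈_ = λ x y → (p : Atom) → _≈_ (F p) (x p) (y p)
  ; isEq = record
      { refl = λ p → IsEquivalence.refl (isEq (F p))
      ; sym = λ e p → IsEquivalence.sym (isEq (F p)) (e p)
      ; trans = λ e e' p → IsEquivalence.trans (isEq (F p)) (e p) (e' p) }
  ; act = λ f x p → act (F p) f (x p)
  ; act-cong = λ f e p → act-cong (F p) f (e p)
  }

-- Exponentials: [F → G](w) = natural transformations 𝒲(-,w) × F → G

record ExpEl (F G : PSh) (w : World) : Set₁ where
  field
    fun      : ∀ {v} → Hom v w → Ob F v → Ob G v
    fun-cong : ∀ {v} (h : Hom v w) {x y : Ob F v} → _≈_ F x y → _≈_ G (fun h x) (fun h y)
    fun-nat  : ∀ {u v} (h : Hom v w) (k : Hom u v) (x : Ob F v)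
             → _≈_ G (fun (h ∘W k) (act F k x)) (act G k (fun h x))
open ExpEl public

[_⇒_] : PSh → PSh → PSh
[ F ⇒ G ] = record
  { Ob = ExpEl F G
  ; _≈_ = λ α β → ∀ {v} (h : Hom v _) (x : Ob F v) → _≈_ G (fun α h x) (fun β h x)
  ; isEq = record
      { refl = λ h x → IsEquivalence.refl (isEq G)
      ; sym = λ e h x → IsEquivalence.sym (isEq G) (e h x)
      ; trans = λ e e' h x → IsEquivalence.trans (isEq G) (e h x) (e' h x) }
  ; act = actE
  ; act-cong = λ f e h x → e (f ∘W h) x
  }
  where
  actE : ∀ {v w} → Hom v w → ExpEl F G w → ExpEl F G v
  fun (actE f α) h x = fun α (f ∘W h) x
  fun-cong (actE f α) h e = fun-cong α (f ∘W h) e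
  fun-nat (actE f α) h k x rewrite sym (∘W-assoc f h k) = fun-nat α (f ∘W h) k x

⟦atom⟧ : Atom → PSh
⟦atom⟧ p = record
  { Ob = λ w → Level.Lift (lsuc 0ℓ) (Der (base w) (ctx w) p)
  ; _≈_ = _≡_
  ; isEq = isEquivalence
  ; act = λ f d → Level.lift (substH f (Level.lower d))
  ; act-cong = λ f e → cong _ e
  }

⟦_⟧ : Formula → PSh
⟦ atom p ⟧ = ⟦atom⟧ p
⟦ ⊥f ⟧     = ΠA ⟦atom⟧
⟦ φ ∧ ψ ⟧  = ⟦ φ ⟧ ×P ⟦ ψ ⟧
⟦ φ ⊃ ψ ⟧  = [ ⟦ φ ⟧ ⇒ ⟦ ψ ⟧ ]
⟦ φ ∨ ψ ⟧  = ΠA (λ p → [ [ ⟦ φ ⟧ ⇒ ⟦atom⟧ p ] ⇒ [ [ ⟦ ψ ⟧ ⇒ ⟦atom⟧ p ] ⇒ ⟦atom⟧ p ] ])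

σ : PSh → PSh → PSh
σ A B = ΠA (λ p → [ [ A ⇒ ⟦atom⟧ p ] ⇒ [ [ B ⇒ ⟦atom⟧ p ] ⇒ ⟦atom⟧ p ] ])

SupportsDisjElim : (PSh → PSh → PSh) → PSh → PSh → PSh → Set₁
SupportsDisjElim s A B C = Mor (s A B ×P ([ A ⇒ C ] ×P [ B ⇒ C ])) C

{-# OPTIONS --safe #-}

-- The presheaves C admitting a morphism σ(A,B) × [A → C] × [B → C] → C contain
-- every ⟦p⟧ (apply the component of σ(A,B) at p to the two arrows) and are closed
-- under products and under exponentials [D → C]: at a stage with argument d : D,
-- instantiate both arrows A → [D → C] and B → [D → C] at d and eliminate into C.
-- Induction on φ then covers every ⟦φ⟧; the exponential step only needs the action
-- of D to respect composition, which every ⟦φ⟧ satisfies.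

module Submission where

open import Defs
open import Level using (lift; lower)
open import Data.List using ([]; _∷_; _++_)
open import Data.List.Membership.Propositional using (_∈_)
open import Data.List.Relation.Unary.All as All using (All; []; _∷_)
open import Data.List.Relation.Unary.All.Properties as AllP using ()
open import Data.List.Relation.Unary.Any using (here; there)
open import Data.List.Relation.Unary.Any.Properties using (++⁺ˡ; ++⁻; ++⁺∘++⁻)
open import Data.Product using (_,_; proj₁; proj₂)
open import Data.Sum using (inj₁; inj₂)
open import Function using (_∘_)
open import Relation.Binary.Bundles using (Setoid)
open import Relation.Binary.Structures using (IsEquivalence)
open import Relation.Binary.PropositionalEquality using (_≡_; refl; sym; trans; cong; cong₂)
import Relation.Binary.Reasoning.Setoid as SetoidReasoning

exts-var : ∀ {B Γ P p} {τ : Sub B Γ Γ} → (∀ {q} (x : q ∈ Γ) → τ x ≡ var x)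
         → (x : p ∈ Γ ++ P) → exts {P = P} τ x ≡ var x
exts-var {Γ = Γ} τ≗var x with ++⁻ Γ x | ++⁺∘++⁻ Γ x
... | inj₁ y | refl = cong (rename ++⁺ˡ) (τ≗var y)
... | inj₂ y | refl = refl

mutual
  subst-var : ∀ {B Γ p} .(i : B ⊆B B) {τ : Sub B Γ Γ}
            → (∀ {q} (x : q ∈ Γ) → τ x ≡ var x) → (d : Der B Γ p) → subst i τ d ≡ d
  subst-var i τ≗var (var x)       = τ≗var x
  subst-var i τ≗var (rule R m ds) = cong (rule R _) (substs-var i τ≗var ds)

  substs-var : ∀ {B Γ ps} .(i : B ⊆B B) {τ : Sub B Γ Γ}
             → (∀ {q} (x : q ∈ Γ) → τ x ≡ var x) → (ds : Ders B Γ ps) → substs i τ ds ≡ ds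
  substs-var i τ≗var []       = refl
  substs-var i τ≗var (d ∷ ds) =
    cong₂ _∷_ (subst-var i (exts-var τ≗var) d) (substs-var i τ≗var ds)

module _ {P : Atom → Set} where

  lookup-tabulate : ∀ {xs} (f : ∀ {x} → x ∈ xs → P x) {q} (x : q ∈ xs)
                  → All.lookup (All.tabulate f) x ≡ f x
  lookup-tabulate f (here refl) = refl
  lookup-tabulate f (there x)   = lookup-tabulate (f ∘ there) x

  tabulate-lookup : ∀ {xs} (t : All P xs) → All.tabulate (All.lookup t) ≡ t
  tabulate-lookup []      = refl
  tabulate-lookup (d ∷ t) = cong (d ∷_) (tabulate-lookup t)

  map-tabulate : ∀ {Q : Atom → Set} {xs}
                 (g : ∀ {x} → P x → Q x) (f : ∀ {x} → x ∈ xs → P x)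
               → All.map g (All.tabulate f) ≡ All.tabulate (g ∘ f)
  map-tabulate {xs = []}     g f = refl
  map-tabulate {xs = a ∷ xs} g f = cong (_ ∷_) (map-tabulate g (f ∘ there))

∘W-identityʳ : ∀ {v w} (f : Hom v w) → f ∘W idW ≡ f
∘W-identityʳ {v} (hom i t) = cong (hom _) (trans (AllP.map-cong t subst-idW) (AllP.map-id t))
  where
  subst-idW : ∀ {p} (d : Der (base v) (ctx v) p) → substH idW d ≡ d
  subst-idW = subst-var _ (lookup-tabulate {P = Der (base v) (ctx v)} var)

∘W-identityˡ : ∀ {v w} (f : Hom v w) → idW ∘W f ≡ f
∘W-identityˡ {w = w} (hom i t) =
  cong (hom _) (trans (map-tabulate {P = Der (base w) (ctx w)} _ var) (tabulate-lookup t))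

-- A derivation d of p is the morphism into the one-variable world p, and
-- substH f d is then the composite with f.
substH-∘ : ∀ {u v w p} (f : Hom v w) (g : Hom u v) (d : Der (base w) (ctx w) p)
         → substH (f ∘W g) d ≡ substH g (substH f d)
substH-∘ f g d =
  sym (cong (All.head ∘ terms) (∘W-assoc (hom (λ R m → m) (d ∷ [])) f g))

module _ (F : PSh) {w : World} where
  open IsEquivalence (isEq F {w}) public
    using () renaming (refl to ≈-refl; sym to ≈-sym; trans to ≈-trans)

  setoid : Setoid _ _
  setoid = record { isEquivalence = isEq F {w} }

fun-cong-hom : ∀ {F G v w} (α : ExpEl F G w) {h h' : Hom v w} → h ≡ h' → (x : Ob F v)
             → _≈_ G (fun α h x) (fun α h' x)
fun-cong-hom {G = G} α refl x = ≈-refl G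

idW-comm : ∀ {v w} (k : Hom v w) → k ∘W idW ≡ idW ∘W k
idW-comm k = trans (∘W-identityʳ k) (sym (∘W-identityˡ k))

fun-nat-id : ∀ {F G v w} (α : ExpEl F G w) (k : Hom v w) (x : Ob F w)
           → _≈_ G (fun α (k ∘W idW) (act F k x)) (act G k (fun α idW x))
fun-nat-id {F} {G} α k x =
  ≈-trans G (fun-cong-hom α (idW-comm k) (act F k x)) (fun-nat α idW k x)

Act-∘ : PSh → Set₁
Act-∘ F = ∀ {u v w} (f : Hom v w) (g : Hom u v) (x : Ob F w)
        → _≈_ F (act F (f ∘W g) x) (act F g (act F f x))

act-∘-⟦atom⟧ : ∀ p → Act-∘ (⟦atom⟧ p)
act-∘-⟦atom⟧ p f g x = cong lift (substH-∘ f g (lower x))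

act-∘-×P : ∀ F G → Act-∘ F → Act-∘ G → Act-∘ (F ×P G)
act-∘-×P F G act-∘F act-∘G f g (x , y) = act-∘F f g x , act-∘G f g y

act-∘-ΠA : ∀ F → (∀ p → Act-∘ (F p)) → Act-∘ (ΠA F)
act-∘-ΠA F act-∘F f g x p = act-∘F p f g (x p)

act-∘-⇒ : ∀ F G → Act-∘ [ F ⇒ G ]
act-∘-⇒ F G f g α h x = fun-cong-hom α (∘W-assoc f g h) x

act-∘-σ : ∀ A B → Act-∘ (σ A B)
act-∘-σ A B = act-∘-ΠA (λ p → [ [ A ⇒ ⟦atom⟧ p ] ⇒ [ [ B ⇒ ⟦atom⟧ p ] ⇒ ⟦atom⟧ p ] ])
                       (λ p → act-∘-⇒ _ _)

act-∘-⟦⟧ : ∀ φ → Act-∘ ⟦ φ ⟧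
act-∘-⟦⟧ (atom p) = act-∘-⟦atom⟧ p
act-∘-⟦⟧ ⊥f      = act-∘-ΠA ⟦atom⟧ act-∘-⟦atom⟧
act-∘-⟦⟧ (φ ∧ ψ) = act-∘-×P ⟦ φ ⟧ ⟦ ψ ⟧ (act-∘-⟦⟧ φ) (act-∘-⟦⟧ ψ)
act-∘-⟦⟧ (φ ∨ ψ) = act-∘-σ ⟦ φ ⟧ ⟦ ψ ⟧
act-∘-⟦⟧ (φ ⊃ ψ) = act-∘-⇒ ⟦ φ ⟧ ⟦ ψ ⟧

idM : ∀ {F} → Mor F F
η idM x = x
η-cong idM e = e
natural (idM {F}) f x = ≈-refl F

infixr 9 _∘M_
_∘M_ : ∀ {F G H} → Mor G H → Mor F G → Mor F H
η (β ∘M α) x = η β (η α x)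
η-cong (β ∘M α) e = η-cong β (η-cong α e)
natural (_∘M_ {H = H} β α) f x =
  ≈-trans H (η-cong β (natural α f x)) (natural β f (η α x))

π₁ : ∀ {F G} → Mor (F ×P G) F
η π₁ = proj₁
η-cong π₁ = proj₁
natural (π₁ {F}) f x = ≈-refl F

π₂ : ∀ {F G} → Mor (F ×P G) G
η π₂ = proj₂
η-cong π₂ = proj₂
natural (π₂ {G = G}) f x = ≈-refl G

⟨_,_⟩M : ∀ {F G H} → Mor F G → Mor F H → Mor F (G ×P H)
η ⟨ α , β ⟩M x = η α x , η β x
η-cong ⟨ α , β ⟩M e = η-cong α e , η-cong β e
natural ⟨ α , β ⟩M f x = natural α f x , natural β f x

infixr 2 _×M_
_×M_ : ∀ {F F' G G'} → Mor F F' → Mor G G' → Mor (F ×P G) (F' ×P G')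
α ×M β = ⟨ α ∘M π₁ , β ∘M π₂ ⟩M

projA : ∀ {F} p → Mor (ΠA F) (F p)
η (projA p) x = x p
η-cong (projA p) e = e p
natural (projA {F} p) f x = ≈-refl (F p)

tupleA : ∀ {F G} → (∀ p → Mor F (G p)) → Mor F (ΠA G)
η (tupleA α) x p = η (α p) x
η-cong (tupleA α) e p = η-cong (α p) e
natural (tupleA α) f x p = natural (α p) f x

postcomp : ∀ {X F G} → Mor F G → Mor [ X ⇒ F ] [ X ⇒ G ]
fun (η (postcomp α) β) h x = η α (fun β h x)
fun-cong (η (postcomp α) β) h e = η-cong α (fun-cong β h e)
fun-nat (η (postcomp {G = G} α) β) h k x =
  ≈-trans G (η-cong α (fun-nat β h k x)) (natural α k (fun β h x))
η-cong (postcomp α) e h x = η-cong α (e h x)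
natural (postcomp {G = G} α) f β h x = ≈-refl G

module Apply {D C : PSh} (act-∘D : Act-∘ D) where

  applyAt : ∀ {X v} → ExpEl X [ D ⇒ C ] v → Ob D v → ExpEl X C v
  fun (applyAt α d) h a = fun (fun α h a) idW (act D h d)
  fun-cong (applyAt α d) h e = fun-cong α h e idW (act D h d)
  fun-nat (applyAt {X} α d) h k a = begin
      fun (fun α (h ∘W k) (act X k a)) idW (act D (h ∘W k) d)
    ≈⟨ fun-cong (fun α (h ∘W k) (act X k a)) idW (act-∘D h k d) ⟩
      fun (fun α (h ∘W k) (act X k a)) idW (act D k (act D h d))
    ≈⟨ fun-nat α h k a idW (act D k (act D h d)) ⟩
      fun (fun α h a) (k ∘W idW) (act D k (act D h d))
    ≈⟨ fun-nat-id (fun α h a) k (act D h d) ⟩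
      act C k (fun (fun α h a) idW (act D h d))
    ∎
    where open SetoidReasoning (setoid C)

  applyAt-cong : ∀ {X v} {α β : ExpEl X [ D ⇒ C ] v} {d d' : Ob D v}
               → _≈_ [ X ⇒ [ D ⇒ C ] ] α β → _≈_ D d d'
               → _≈_ [ X ⇒ C ] (applyAt α d) (applyAt β d')
  applyAt-cong {β = β} α≈β d≈d' h a =
    ≈-trans C (α≈β h a idW _) (fun-cong (fun β h a) idW (act-cong D h d≈d'))

  applyAt-act : ∀ {X u v} (k : Hom u v) (α : ExpEl X [ D ⇒ C ] v) (d : Ob D v)
              → _≈_ [ X ⇒ C ] (applyAt (act [ X ⇒ [ D ⇒ C ] ] k α) (act D k d))
                              (act [ X ⇒ C ] k (applyAt α d))
  applyAt-act k α d h a = fun-cong (fun α (k ∘W h) a) idW (≈-sym D (act-∘D k h d))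

module DisjElim (A B : PSh) where

  Premises : PSh → PSh
  Premises C = σ A B ×P ([ A ⇒ C ] ×P [ B ⇒ C ])

  act-∘-Premises : ∀ C → Act-∘ (Premises C)
  act-∘-Premises C =
    act-∘-×P (σ A B) ([ A ⇒ C ] ×P [ B ⇒ C ]) (act-∘-σ A B)
             (act-∘-×P [ A ⇒ C ] [ B ⇒ C ] (act-∘-⇒ A C) (act-∘-⇒ B C))

  mapPremises : ∀ {F G} → Mor F G → Mor (Premises F) (Premises G)
  mapPremises α = idM ×M postcomp α ×M postcomp α

  disjElim-⟦atom⟧ : ∀ p → SupportsDisjElim σ A B (⟦atom⟧ p)
  η (disjElim-⟦atom⟧ p) (s , f , g) = fun (fun (s p) idW f) idW g
  η-cong (disjElim-⟦atom⟧ p) {x = s , f , g} {s' , f' , g'} (s≈s' , f≈f' , g≈g') =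
    trans (s≈s' p idW f idW g)
          (trans (fun-cong (s' p) idW f≈f' idW g) (fun-cong (fun (s' p) idW f') idW g≈g'))
  natural (disjElim-⟦atom⟧ p) k (s , f , g) =
    trans (fun-nat-id (s p) k f idW (act [ B ⇒ ⟦atom⟧ p ] k g))
          (fun-nat-id (fun (s p) idW f) k g)

  disjElim-×P : ∀ {F G} → SupportsDisjElim σ A B F → SupportsDisjElim σ A B G
              → SupportsDisjElim σ A B (F ×P G)
  disjElim-×P eF eG = ⟨ eF ∘M mapPremises π₁ , eG ∘M mapPremises π₂ ⟩M

  disjElim-ΠA : ∀ {F} → (∀ p → SupportsDisjElim σ A B (F p))
              → SupportsDisjElim σ A B (ΠA F)
  disjElim-ΠA e = tupleA (λ p → e p ∘M mapPremises (projA p))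

  module _ {D C : PSh} (act-∘D : Act-∘ D) where

    open Apply {D} {C} act-∘D

    P⇒ : PSh
    P⇒ = Premises [ D ⇒ C ]

    instantiate : ∀ {v} → Ob D v → Ob P⇒ v → Ob (Premises C) v
    instantiate d (s , f , g) = s , applyAt f d , applyAt g d

    instantiate-cong : ∀ {v} {d d' : Ob D v} (x y : Ob P⇒ v) → _≈_ D d d' → _≈_ P⇒ x y
                     → _≈_ (Premises C) (instantiate d x) (instantiate d' y)
    instantiate-cong (_ , f , g) (_ , f' , g') d≈d' (s≈s' , f≈f' , g≈g') =
      s≈s' , applyAt-cong {α = f} {f'} f≈f' d≈d' , applyAt-cong {α = g} {g'} g≈g' d≈d'

    instantiate-act : ∀ {u v} (k : Hom u v) (d : Ob D v) (x : Ob P⇒ v)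
                    → _≈_ (Premises C) (instantiate (act D k d) (act P⇒ k x))
                                       (act (Premises C) k (instantiate d x))
    instantiate-act k d (s , f , g) =
      ≈-refl (σ A B) {x = act (σ A B) k s} , applyAt-act k f d , applyAt-act k g d

    disjElim-⇒ : SupportsDisjElim σ A B C → SupportsDisjElim σ A B [ D ⇒ C ]
    fun (η (disjElim-⇒ e) x) h d = η e (instantiate d (act P⇒ h x))
    fun-cong (η (disjElim-⇒ e) x) h d≈d' =
      η-cong e (instantiate-cong x′ x′ d≈d' (≈-refl P⇒ {x = x′}))
      where x′ = act P⇒ h x
    fun-nat (η (disjElim-⇒ e) x) h k d = begin
        η e (instantiate (act D k d) (act P⇒ (h ∘W k) x))
      ≈⟨ η-cong e (instantiate-cong (act P⇒ (h ∘W k) x) (act P⇒ k (act P⇒ h x))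
                                    (≈-refl D) (act-∘-Premises [ D ⇒ C ] h k x)) ⟩
        η e (instantiate (act D k d) (act P⇒ k (act P⇒ h x)))
      ≈⟨ η-cong e (instantiate-act k d (act P⇒ h x)) ⟩
        η e (act (Premises C) k (instantiate d (act P⇒ h x)))
      ≈⟨ natural e k (instantiate d (act P⇒ h x)) ⟩
        act C k (η e (instantiate d (act P⇒ h x)))
      ∎
      where open SetoidReasoning (setoid C)
    η-cong (disjElim-⇒ e) {x = x} {y} x≈y h d =
      η-cong e (instantiate-cong (act P⇒ h x) (act P⇒ h y)
                                 (≈-refl D {x = d}) (act-cong P⇒ h {x} {y} x≈y))
    natural (disjElim-⇒ e) k x h d =
      η-cong e (instantiate-cong x′ y′ (≈-refl D {x = d})
                                 (≈-sym P⇒ {x = y′} {x′} (act-∘-Premises [ D ⇒ C ] k h x)))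
      where
      x′ = act P⇒ h (act P⇒ k x)
      y′ = act P⇒ (k ∘W h) x

  disjElim-⟦⟧ : ∀ φ → SupportsDisjElim σ A B ⟦ φ ⟧
  disjElim-⟦⟧ (atom p) = disjElim-⟦atom⟧ p
  disjElim-⟦⟧ ⊥f      = disjElim-ΠA disjElim-⟦atom⟧
  disjElim-⟦⟧ (φ ∧ ψ) = disjElim-×P (disjElim-⟦⟧ φ) (disjElim-⟦⟧ ψ)
  disjElim-⟦⟧ (φ ∨ ψ) = disjElim-ΠA λ p →
    disjElim-⇒ (act-∘-⇒ ⟦ φ ⟧ (⟦atom⟧ p))
      (disjElim-⇒ (act-∘-⇒ ⟦ ψ ⟧ (⟦atom⟧ p)) (disjElim-⟦atom⟧ p))
  disjElim-⟦⟧ (φ ⊃ ψ) = disjElim-⇒ (act-∘-⟦⟧ φ) (disjElim-⟦⟧ ψ)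

lemma15 : (A B : Presheaf) (φ : Formula) → SupportsDisjElim σ (psh A) (psh B) ⟦ φ ⟧
lemma15 A B = DisjElim.disjElim-⟦⟧ (psh A) (psh B)
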